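{- If $\mathbb{F}$ is an n-frame (resp. c-frame) and $\phi\vdash\psi$ is an $\mathcal{L}_\nabla$-sequent (resp. $\phi$ is an $\mathcal{L}_>$-formula), then $\mathbb{F}\Vdash\phi\vdash\psi$ iff $\mathbb{F}^\star\Vdash\tau_1(\phi)\vdash\tau_2(\psi)$ (resp. $\mathbb{F}\Vdash\phi$ iff $\mathbb{F}^\star\Vdash\phi^\tau$).
   Context: $\mathcal{L}_\nabla\ni\phi::=p\mid\neg\phi\mid\phi\wedge\phi\mid\nabla\phi$ and $\mathcal{L}_>\ni\phi::=p\mid\neg\phi\mid\phi\wedge\phi\mid\phi>\phi$, interpreted on n-frames $(W,\nu)$ (monotone) by $w\Vdash\nabla\phi$ iff $V(\phi)\in\nu(w)$, and on c-frames $(W,f)$ by $w\Vdash\phi>\psi$ iff $f(w,V(\phi))\subseteq V(\psi)$. The two-sorted languages have sort $\mathsf{S}$ (evaluated on $W$) and sort $\mathsf{N}$ (evaluated on $\mathcal{P}(W)$), with connectives $\langle\nu\rangle,[\nu^c]$ from $\mathsf{N}$ to $\mathsf{S}$, $[\ni],\langle\not\ni\rangle,[\not\ni\rangle$ from $\mathsf{S}$ to $\mathsf{N}$, and $\vartriangleright:\mathsf{N}\times\mathsf{S}\to\mathsf{S}$. $\mathbb{F}^\star$ is the two-sorted frame on $(W,\mathcal{P}(W))$ with $xR_\nu Z$ iff $Z\in\nu(x)$, $xR_{\nu^c}Z$ iff $Z\notin\nu(x)$, $ZR_\ni x$ iff $x\in Z$, $ZR_{\not\ni}x$ iff $x\notin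 Z$, $T_f(x,Z,x')$ iff $x'\in f(x,Z)$; truth: $x\Vdash\langle\nu\rangle\alpha$ iff some $y$ with $xR_\nu y$ satisfies $\alpha$; $x\Vdash[\nu^c]\alpha$ iff all $y$ with $xR_{\nu^c}y$ satisfy $\alpha$; $y\Vdash[\ni]A$ iff all $x$ with $yR_\ni x$ satisfy $A$; $y\Vdash\langle\not\ni\rangle A$ iff some $x$ with $yR_{\not\ni}x$ satisfies $A$; $y\Vdash[\not\ni\rangle A$ iff all $x$ with $yR_{\not\ni}x$ fail $A$; $x\Vdash\alpha\vartriangleright A$ iff for all $y,x'$ with $T_f(x,y,x')$ and $y\Vdash\alpha$, $x'\Vdash A$. Translations: $\tau_1(p)=\tau_2(p)=p$; $\tau_i(\phi\wedge\psi)=\tau_i(\phi)\wedge\tau_i(\psi)$; $\tau_1(\neg\phi)=\neg\tau_2(\phi)$, $\tau_2(\neg\phi)=\neg\tau_1(\phi)$; $\tau_1(\nabla\phi)=\langle\nu\rangle[\ni]\tau_1(\phi)$, $\tau_2(\nabla\phi)=[\nu^c]\langle\not\ni\rangle\tau_2(\phi)$; $p^\tau=p$, $(\phi\wedge\psi)^\tau=\phi^\tau\wedge\psi^\tau$, $(\neg\phi)^\tau=\neg\phi^\tau$, $(\phi>\psi)^\tau=([\ni]\phi^\tau\wedge[\not\ni\rangle\phi^\tau)\vartriangleright\psi^\tau$. -}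

module Defs where

open import Level using (Level; Lift; lift; 0ℓ) renaming (suc to lsuc)
open import Data.Nat using (ℕ)
open import Data.Product using (Σ; _×_; _,_)
open import Relation.Nullary using (¬_)

Subset : Set → Set₁
Subset W = W → Set

_⊆_ : {W : Set} → Subset W → Subset W → Set
X ⊆ Y = ∀ x → X x → Y x

_≐_ : {W : Set} → Subset W → Subset W → Set
X ≐ Y = (X ⊆ Y) × (Y ⊆ X)

data Lnab : Set where
  var  : ℕ → Lnab
  neg  : Lnab → Lnab
  conj : Lnab → Lnab → Lnab
  nab  : Lnab → Lnab

data Lcond : Set where
  var  : ℕ → Lcond
  neg  : Lcond → Lcond
  conj : Lcond → Lcond → Lcond
  cnd  : Lcond → Lcond → Lcond

record NFrame : Set₂ where
  field
    W    : Set
    ν    : W → Subset W → Set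
    mono : ∀ w (X Y : Subset W) → ν w X → X ⊆ Y → ν w Y

record CFrame : Set₂ where
  field
    W   : Set
    f   : W → Subset W → Subset W
    -- f is a function on P(W): it respects (extensional) equality of subsets
    ext : ∀ w (X Y : Subset W) → X ≐ Y → f w X ≐ f w Y

module _ (F : NFrame) where
  open NFrame F
  Val-n : Set₁
  Val-n = ℕ → Subset W

  sat-n : Val-n → W → Lnab → Set
  sat-n V w (var p)    = V p w
  sat-n V w (neg φ)    = ¬ sat-n V w φ
  sat-n V w (conj φ ψ) = sat-n V w φ × sat-n V w ψ
  sat-n V w (nab φ)    = ν w (λ u → sat-n V u φ)

  valid-seq-n : Lnab → Lnab → Set₁
  valid-seq-n φ ψ = ∀ (V : Val-n) (w : W) → sat-n V w φ → sat-n V w ψ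

module _ (F : CFrame) where
  open CFrame F
  Val-c : Set₁
  Val-c = ℕ → Subset W

  sat-c : Val-c → W → Lcond → Set
  sat-c V w (var p)    = V p w
  sat-c V w (neg φ)    = ¬ sat-c V w φ
  sat-c V w (conj φ ψ) = sat-c V w φ × sat-c V w ψ
  sat-c V w (cnd φ ψ)  = ∀ u → f w (λ v → sat-c V v φ) u → sat-c V u ψ

  valid-c : Lcond → Set₁
  valid-c φ = ∀ (V : Val-c) (w : W) → sat-c V w φ

data Sort : Set where
  S N : Sort

data TFn : Sort → Set where
  var   : ∀ {s} → ℕ → TFn s
  neg   : ∀ {s} → TFn s → TFn s
  conj  : ∀ {s} → TFn s → TFn s → TFn s
  ⟨ν⟩   : TFn N → TFn S
  [νᶜ]  : TFn N → TFn S
  [∋]   : TFn S → TFn N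
  ⟨∌⟩   : TFn S → TFn N

data TFc : Sort → Set where
  var   : ∀ {s} → ℕ → TFc s
  neg   : ∀ {s} → TFc s → TFc s
  conj  : ∀ {s} → TFc s → TFc s → TFc s
  [∋]   : TFc S → TFc N
  [∌⟩   : TFc S → TFc N
  _▷_   : TFc N → TFc S → TFc S

Dom : Set → Sort → Set₁
Dom W S = Lift (lsuc 0ℓ) W
Dom W N = Subset W

record Val2 (W : Set) : Set₂ where
  field
    valS : ℕ → W → Set
    valN : ℕ → Subset W → Set

atom : {W : Set} → Val2 W → (s : Sort) → ℕ → Dom W s → Set₁
atom V S p (lift x) = Lift (lsuc 0ℓ) (Val2.valS V p x)
atom V N p Z        = Lift (lsuc 0ℓ) (Val2.valN V p Z)

module _ (F : NFrame) where
  open NFrame F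
  sat⋆-n : Val2 W → {s : Sort} → Dom W s → TFn s → Set₁
  sat⋆-n V {s} d (var p)    = atom V s p d
  sat⋆-n V d (neg α)        = ¬ sat⋆-n V d α
  sat⋆-n V d (conj α β)     = sat⋆-n V d α × sat⋆-n V d β
  sat⋆-n V (lift x) (⟨ν⟩ α)  = Σ (Subset W) λ Z → Lift (lsuc 0ℓ) (ν x Z) × sat⋆-n V {N} Z α
  sat⋆-n V (lift x) ([νᶜ] α) = ∀ (Z : Subset W) → ¬ ν x Z → sat⋆-n V {N} Z α
  sat⋆-n V Z ([∋] A)         = ∀ (x : W) → Z x → sat⋆-n V {S} (lift x) A
  sat⋆-n V Z (⟨∌⟩ A)         = Σ W λ x → ¬ Z x × sat⋆-n V {S} (lift x) A

  valid⋆-seq-n : TFn S → TFn S → Set₂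
  valid⋆-seq-n A B = ∀ (V : Val2 W) (x : W) → sat⋆-n V {S} (lift x) A → sat⋆-n V {S} (lift x) B

module _ (F : CFrame) where
  open CFrame F
  sat⋆-c : Val2 W → {s : Sort} → Dom W s → TFc s → Set₁
  sat⋆-c V {s} d (var p)    = atom V s p d
  sat⋆-c V d (neg α)        = ¬ sat⋆-c V d α
  sat⋆-c V d (conj α β)     = sat⋆-c V d α × sat⋆-c V d β
  sat⋆-c V Z ([∋] A)        = ∀ (x : W) → Z x → sat⋆-c V {S} (lift x) A
  sat⋆-c V Z ([∌⟩ A)        = ∀ (x : W) → ¬ Z x → ¬ sat⋆-c V {S} (lift x) A
  sat⋆-c V (lift x) (α ▷ A) = ∀ (Z : Subset W) (x' : W) → f x Z x' → sat⋆-c V {N} Z α → sat⋆-c V {S} (lift x') A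

  valid⋆-c : TFc S → Set₂
  valid⋆-c A = ∀ (V : Val2 W) (x : W) → sat⋆-c V {S} (lift x) A

mutual
  τ₁ : Lnab → TFn S
  τ₁ (var p)    = var p
  τ₁ (conj φ ψ) = conj (τ₁ φ) (τ₁ ψ)
  τ₁ (neg φ)    = neg (τ₂ φ)
  τ₁ (nab φ)    = ⟨ν⟩ ([∋] (τ₁ φ))

  τ₂ : Lnab → TFn S
  τ₂ (var p)    = var p
  τ₂ (conj φ ψ) = conj (τ₂ φ) (τ₂ ψ)
  τ₂ (neg φ)    = neg (τ₁ φ)
  τ₂ (nab φ)    = [νᶜ] (⟨∌⟩ (τ₂ φ))

_ᵗ : Lcond → TFc S
var p ᵗ      = var p
conj φ ψ ᵗ   = conj (φ ᵗ) (ψ ᵗ)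
neg φ ᵗ      = neg (φ ᵗ)
cnd φ ψ ᵗ    = conj ([∋] (φ ᵗ)) ([∌⟩ (φ ᵗ)) ▷ (ψ ᵗ)

-- Both τ₁ φ and τ₂ φ hold at x in F⋆ exactly when φ holds at x in F under the sort-S part of
-- the valuation, so the two notions of validity coincide. For τ₁ (∇φ) this is monotonicity:
-- ν x ⟦φ⟧ iff some neighbourhood lies inside ⟦φ⟧. For τ₂ (∇φ) it is the contrapositive: ν x ⟦φ⟧
-- iff every non-neighbourhood misses a point of ⟦φ⟧. For φ > ψ, the antecedent
-- [∋]φᵗ ∧ [∌⟩φᵗ pins the neighbourhood argument down to exactly ⟦φ⟧, and f respects ≐.
-- The last two steps are classical.
module Submission where

open import Defs
open import Level using (Lift; lift; lower; 0ℓ) renaming (suc to lsuc)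
open import Data.Nat using (ℕ)
open import Data.Empty using (⊥)
open import Data.Product using (Σ; _×_; _,_; proj₁)
open import Relation.Nullary using (¬_)
open import Function using (case_of_)
open import Function.Bundles using (_⇔_; mk⇔; Equivalence)
open import Function.Related.TypeIsomorphisms using (¬-cong-⇔)
open import Data.Product.Function.NonDependent.Propositional using (_×-⇔_)
open import Axiom.ExcludedMiddle using (ExcludedMiddle)
open import Axiom.DoubleNegationElimination using (DoubleNegationElimination; em⇒dne)

open Equivalence using (to; from)

Lift-⇔ : {A : Set} → Lift (lsuc 0ℓ) A ⇔ A
Lift-⇔ = mk⇔ lower lift

module Classical (dne : DoubleNegationElimination (lsuc 0ℓ)) where

  dne₀ : {A : Set} → ¬ ¬ A → A
  dne₀ ¬¬a = lower (dne λ ¬la → ¬¬a λ a → ¬la (lift a))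

  ⊆-by-contraposition : {W : Set} {X Y : Subset W} → (∀ y → ¬ Y y → ¬ X y) → X ⊆ Y
  ⊆-by-contraposition X∩∁Y=∅ y Xy = dne₀ λ ¬Yy → X∩∁Y=∅ y ¬Yy Xy

  module _ (F : NFrame) where
    open NFrame F

    ν⇔∃ν-⊆ : ∀ {x} {X : Subset W} {P : W → Set₁} → (∀ y → P y ⇔ X y) →
             (Σ (Subset W) λ Z → Lift (lsuc 0ℓ) (ν x Z) × (∀ y → Z y → P y)) ⇔ ν x X
    ν⇔∃ν-⊆ {x} {X} P⇔X = mk⇔
      (λ { (Z , lift νZ , Z⊆P) → mono x Z X νZ λ y Zy → to (P⇔X y) (Z⊆P y Zy) })
      (λ νX → X , lift νX , λ y → from (P⇔X y))

    ν⇔∀∉ν-∃∉ : ∀ {x} {X : Subset W} {P : W → Set₁} → (∀ y → P y ⇔ X y) →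
               (∀ Z → ¬ ν x Z → Σ W λ y → ¬ Z y × P y) ⇔ ν x X
    ν⇔∀∉ν-∃∉ {x} {X} P⇔X = mk⇔
      (λ h → dne₀ λ ¬νX → case h X ¬νX of λ { (y , ¬Xy , Py) → ¬Xy (to (P⇔X y) Py) })
      (λ νX Z ¬νZ → dne λ none → ¬νZ (mono x X Z νX
        (⊆-by-contraposition λ y ¬Zy Xy → none (y , ¬Zy , from (P⇔X y) Xy))))

  module _ (F : CFrame) where
    open CFrame F

    ≐-from-bounds : ∀ {X Z : Subset W} {P : W → Set₁} → (∀ y → P y ⇔ X y) →
                    (∀ y → Z y → P y) × (∀ y → ¬ Z y → ¬ P y) → Z ≐ X
    ≐-from-bounds P⇔X (Z⊆P , ∁Z∩P=∅) =
        (λ y Zy → to (P⇔X y) (Z⊆P y Zy))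
      , ⊆-by-contraposition λ y ¬Zy Xy → ∁Z∩P=∅ y ¬Zy (from (P⇔X y) Xy)

    ▷⇔f-⊆ : ∀ {x} {X Y : Subset W} {P Q : W → Set₁} → (∀ y → P y ⇔ X y) → (∀ u → Q u ⇔ Y u) →
            (∀ Z u → f x Z u → (∀ y → Z y → P y) × (∀ y → ¬ Z y → ¬ P y) → Q u)
              ⇔ (∀ u → f x X u → Y u)
    ▷⇔f-⊆ {x} {X} P⇔X Q⇔Y = mk⇔
      (λ h u fXu → to (Q⇔Y u) (h X u fXu ((λ y → from (P⇔X y)) , λ y ¬Xy Py → ¬Xy (to (P⇔X y) Py))))
      (λ h Z u fZu bounds →
        from (Q⇔Y u) (h u (proj₁ (ext x Z X (≐-from-bounds P⇔X bounds)) u fZu)))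

  module NTruth (F : NFrame) (V : Val2 (NFrame.W F)) where
    open NFrame F

    ⟦_⟧ : Lnab → Subset W
    ⟦ φ ⟧ x = sat-n F (Val2.valS V) x φ

    mutual
      τ₁-correct : ∀ φ x → sat⋆-n F V (lift x) (τ₁ φ) ⇔ ⟦ φ ⟧ x
      τ₁-correct (var p)    x = Lift-⇔
      τ₁-correct (neg φ)    x = ¬-cong-⇔ (τ₂-correct φ x)
      τ₁-correct (conj φ ψ) x = τ₁-correct φ x ×-⇔ τ₁-correct ψ x
      τ₁-correct (nab φ)    x = ν⇔∃ν-⊆ F (λ y → τ₁-correct φ y)

      τ₂-correct : ∀ φ x → sat⋆-n F V (lift x) (τ₂ φ) ⇔ ⟦ φ ⟧ x
      τ₂-correct (var p)    x = Lift-⇔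
      τ₂-correct (neg φ)    x = ¬-cong-⇔ (τ₁-correct φ x)
      τ₂-correct (conj φ ψ) x = τ₂-correct φ x ×-⇔ τ₂-correct ψ x
      τ₂-correct (nab φ)    x = ν⇔∀∉ν-∃∉ F (λ y → τ₂-correct φ y)

  module CTruth (F : CFrame) (V : Val2 (CFrame.W F)) where
    open CFrame F

    ᵗ-correct : ∀ φ x → sat⋆-c F V (lift x) (φ ᵗ) ⇔ sat-c F (Val2.valS V) x φ
    ᵗ-correct (var p)    x = Lift-⇔
    ᵗ-correct (neg φ)    x = ¬-cong-⇔ (ᵗ-correct φ x)
    ᵗ-correct (conj φ ψ) x = ᵗ-correct φ x ×-⇔ ᵗ-correct ψ x
    ᵗ-correct (cnd φ ψ)  x = ▷⇔f-⊆ F (λ y → ᵗ-correct φ y) (λ u → ᵗ-correct ψ u)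

-- Atoms of sort N never occur in a translated formula, so their interpretation is irrelevant.
extendVal : {W : Set} → (ℕ → Subset W) → Val2 W
extendVal V = record { valS = V ; valN = λ _ _ → ⊥ }

proposition5 : ExcludedMiddle (lsuc Level.zero) →
    (∀ (F : NFrame) (φ ψ : Lnab) →
      valid-seq-n F φ ψ ⇔ valid⋆-seq-n F (τ₁ φ) (τ₂ ψ))
    × (∀ (F : CFrame) (φ : Lcond) →
      valid-c F φ ⇔ valid⋆-c F (φ ᵗ))
proposition5 em = n-frames , c-frames
  where
    open Classical (em⇒dne em)

    n-frames : ∀ F φ ψ → valid-seq-n F φ ψ ⇔ valid⋆-seq-n F (τ₁ φ) (τ₂ ψ)
    n-frames F φ ψ = mk⇔
      (λ valid V x τ₁φ → from (τ₂-correct V ψ x) (valid (Val2.valS V) x (to (τ₁-correct V φ x) τ₁φ)))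
      (λ valid⋆ V x φx → to (τ₂-correct (extendVal V) ψ x)
        (valid⋆ (extendVal V) x (from (τ₁-correct (extendVal V) φ x) φx)))
      where open NTruth F

    c-frames : ∀ F φ → valid-c F φ ⇔ valid⋆-c F (φ ᵗ)
    c-frames F φ = mk⇔
      (λ valid V x → from (ᵗ-correct V φ x) (valid (Val2.valS V) x))
      (λ valid⋆ V x → to (ᵗ-correct (extendVal V) φ x) (valid⋆ (extendVal V) x))
      where open CTruth F
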